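{- For every formula $A$ of $\mathcal L$, the sequent $\Rightarrow A$ is derivable in $\mathsf{G1MK}$ if and only if $A$ is derivable in $\mathsf{MK}$.
   Context: $\mathcal L$ is the language $A ::= p \mid \bot \mid A\wedge A \mid A\vee A \mid A\to A \mid \Box A \mid \Diamond A$. $\mathsf{MPL}$ is axiomatised by $A\wedge B\to A$, $A\wedge B\to B$, $A\to A\vee B$, $B\to A\vee B$, $(A\to B)\to((A\to C)\to(A\to B\wedge C))$, $(A\to C)\to((B\to C)\to(A\vee B\to C))$, $(A\to(B\to C))\to((A\to B)\to(A\to C))$, $A\to(B\to A)$, and modus ponens. $\mathsf{MK}$ extends $\mathsf{MPL}$ with $\Box(A\to B)\to(\Box A\to\Box B)$, $\Box(A\to B)\to(\Diamond A\to\Diamond B)$ and the rule $A/\Box A$. Sequents $\Gamma\Rightarrow C$ have $\Gamma$ a finite multiset of formulas and $C$ a formula; $\Box\Sigma$ prefixes $\Box$ to each member of $\Sigma$; derivations are finite trees from initial sequents via rules. $\mathsf{G1MK}$ consists of: initial sequents $A\Rightarrow A$; (L$\wedge$) $\Gamma,A_i\Rightarrow C$ / $\Gamma,A_1\wedge A_2\Rightarrow C$; (R$\wedge$) $\Gamma\Rightarrow A$, $\Gamma\Rightarrow B$ / $\Gamma\Rightarrow A\wedge B$; (L$\vee$) $\Gamma,A\Rightarrow C$, $\Gamma,B\Rightarrow C$ / $\Gamma,A\vee B\Rightarrow C$; (R$\vee$) $\Gamma\Rightarrow A_i$ / $\Gamma\Rightarrow A_1\vee A_2$; (R$\to$) $\Gamma,A\Rightarrow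 B$ / $\Gamma\Rightarrow A\to B$; (L$\to$) $\Gamma\Rightarrow A$, $\Gamma,B\Rightarrow C$ / $\Gamma,A\to B\Rightarrow C$; (LW) $\Gamma\Rightarrow C$ / $\Gamma,A\Rightarrow C$; (LC) $\Gamma,A,A\Rightarrow C$ / $\Gamma,A\Rightarrow C$; (K$\Box$) $\Sigma\Rightarrow A$ / $\Box\Sigma\Rightarrow\Box A$; (K$\Diamond$) $\Sigma,A\Rightarrow B$ / $\Box\Sigma,\Diamond A\Rightarrow\Diamond B$. -}

module Defs where

open import Data.Nat using (ℕ)
open import Data.List using (List; []; _∷_; map)
open import Data.List.Relation.Binary.Permutation.Propositional using (_↭_)

data Fm : Set where
  var  : ℕ → Fm
  ⊥'   : Fm
  _∧'_ : Fm → Fm → Fm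
  _∨'_ : Fm → Fm → Fm
  _⇒'_ : Fm → Fm → Fm
  □_   : Fm → Fm
  ◇_   : Fm → Fm

infixr 6 _∧'_
infixr 5 _∨'_
infixr 4 _⇒'_

data ⊢MK : Fm → Set where
  ax∧₁ : ∀ {A B} → ⊢MK (A ∧' B ⇒' A)
  ax∧₂ : ∀ {A B} → ⊢MK (A ∧' B ⇒' B)
  ax∨₁ : ∀ {A B} → ⊢MK (A ⇒' A ∨' B)
  ax∨₂ : ∀ {A B} → ⊢MK (B ⇒' A ∨' B)
  ax∧I : ∀ {A B C} → ⊢MK ((A ⇒' B) ⇒' ((A ⇒' C) ⇒' (A ⇒' B ∧' C)))
  ax∨E : ∀ {A B C} → ⊢MK ((A ⇒' C) ⇒' ((B ⇒' C) ⇒' (A ∨' B ⇒' C)))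
  axS  : ∀ {A B C} → ⊢MK ((A ⇒' (B ⇒' C)) ⇒' ((A ⇒' B) ⇒' (A ⇒' C)))
  axK  : ∀ {A B} → ⊢MK (A ⇒' (B ⇒' A))
  axK□ : ∀ {A B} → ⊢MK (□ (A ⇒' B) ⇒' (□ A ⇒' □ B))
  axK◇ : ∀ {A B} → ⊢MK (□ (A ⇒' B) ⇒' (◇ A ⇒' ◇ B))
  mp   : ∀ {A B} → ⊢MK (A ⇒' B) → ⊢MK A → ⊢MK B
  nec  : ∀ {A} → ⊢MK A → ⊢MK (□ A)

-- Sequents: antecedent is a finite multiset, represented as a list taken
-- up to permutation (rule 'perm' below).
record Seq : Set where
  constructor _⇒_
  field
    ante : List Fm
    succ : Fm

infix 2 _⇒_

□* : List Fm → List Fm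
□* = map □_

-- The sequent calculus G1MK.  The context Γ, A is written A ∷ Γ.
data ⊢G1MK : Seq → Set where
  init : ∀ {A} → ⊢G1MK (A ∷ [] ⇒ A)
  perm : ∀ {Γ Δ C} → Γ ↭ Δ → ⊢G1MK (Γ ⇒ C) → ⊢G1MK (Δ ⇒ C)
  L∧₁  : ∀ {Γ A₁ A₂ C} → ⊢G1MK (A₁ ∷ Γ ⇒ C) → ⊢G1MK ((A₁ ∧' A₂) ∷ Γ ⇒ C)
  L∧₂  : ∀ {Γ A₁ A₂ C} → ⊢G1MK (A₂ ∷ Γ ⇒ C) → ⊢G1MK ((A₁ ∧' A₂) ∷ Γ ⇒ C)
  R∧   : ∀ {Γ A B} → ⊢G1MK (Γ ⇒ A) → ⊢G1MK (Γ ⇒ B) → ⊢G1MK (Γ ⇒ (A ∧' B))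
  L∨   : ∀ {Γ A B C} → ⊢G1MK (A ∷ Γ ⇒ C) → ⊢G1MK (B ∷ Γ ⇒ C)
       → ⊢G1MK ((A ∨' B) ∷ Γ ⇒ C)
  R∨₁  : ∀ {Γ A₁ A₂} → ⊢G1MK (Γ ⇒ A₁) → ⊢G1MK (Γ ⇒ (A₁ ∨' A₂))
  R∨₂  : ∀ {Γ A₁ A₂} → ⊢G1MK (Γ ⇒ A₂) → ⊢G1MK (Γ ⇒ (A₁ ∨' A₂))
  R→   : ∀ {Γ A B} → ⊢G1MK (A ∷ Γ ⇒ B) → ⊢G1MK (Γ ⇒ (A ⇒' B))
  L→   : ∀ {Γ A B C} → ⊢G1MK (Γ ⇒ A) → ⊢G1MK (B ∷ Γ ⇒ C)
       → ⊢G1MK ((A ⇒' B) ∷ Γ ⇒ C)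
  LW   : ∀ {Γ A C} → ⊢G1MK (Γ ⇒ C) → ⊢G1MK (A ∷ Γ ⇒ C)
  LC   : ∀ {Γ A C} → ⊢G1MK (A ∷ A ∷ Γ ⇒ C) → ⊢G1MK (A ∷ Γ ⇒ C)
  K□   : ∀ {Σ A} → ⊢G1MK (Σ ⇒ A) → ⊢G1MK (□* Σ ⇒ □ A)
  K◇   : ∀ {Σ A B} → ⊢G1MK (A ∷ Σ ⇒ B) → ⊢G1MK ((◇ A) ∷ □* Σ ⇒ ◇ B)

-- Soundness: read a sequent Γ ⇒ C as "C is derivable in MK from the hypotheses Γ". By the
-- deduction theorem every rule of G1MK is then admissible; K□ and K◇ follow from
-- necessitation and the two K axioms.
--
-- Completeness: the axioms of MK have short derivations, but modus ponens needs a cut,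
-- which G1MK lacks. So we pass through an auxiliary calculus whose contexts are read up to
-- inclusion, whose left rules keep their principal formula, and whose modal rules use all
-- boxed hypotheses at once. There weakening and contraction are built in, and cut is
-- admissible by the usual induction on the cut formula and the two derivations. Its
-- derivations translate back into G1MK, where weakening, contraction and permutation
-- together make any inclusion of antecedents admissible.
{-# OPTIONS --safe #-}
module Submission where

open import Defs
open import Data.List using (List; []; _∷_; _++_; [_]; concatMap)
open import Data.List.Membership.Propositional using (_∈_)
open import Data.List.Membership.Propositional.Properties
  using (∈-map⁻; ∈-concatMap⁻; ∈-∃++)
open import Data.List.Relation.Unary.Any using (here; there)
import Data.List.Relation.Unary.Any as Any
open import Data.List.Relation.Binary.Subset.Propositional using (_⊆_)
open import Data.List.Relation.Binary.Subset.Propositional.Properties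
  using (⊆-refl; ⊆-trans; ⊆-reflexive-↭; ∷⁺ʳ; ∈-∷⁺ʳ; xs⊆x∷xs; xs⊆ys++xs; ++⁺ʳ; concatMap⁺)
open import Data.List.Relation.Binary.Permutation.Propositional
  using (refl; prep; swap; ↭-sym)
open import Data.List.Relation.Binary.Permutation.Propositional.Properties
  using (shift; ++-comm)
open import Data.Product using (_×_; _,_)
open import Relation.Binary.PropositionalEquality using (_≡_; refl)

private variable
  A B C X : Fm
  Γ Δ Θ : List Fm

infix  3 _⊢ᴴ_
infixl 5 _·_

data _⊢ᴴ_ (Γ : List Fm) : Fm → Set where
  hyp : A ∈ Γ → Γ ⊢ᴴ A
  thm : ⊢MK A → Γ ⊢ᴴ A
  _·_ : Γ ⊢ᴴ A ⇒' B → Γ ⊢ᴴ A → Γ ⊢ᴴ B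

⊢ᴴ-weaken : Γ ⊆ Δ → Γ ⊢ᴴ A → Δ ⊢ᴴ A
⊢ᴴ-weaken s (hyp p) = hyp (s p)
⊢ᴴ-weaken s (thm d) = thm d
⊢ᴴ-weaken s (d · e) = ⊢ᴴ-weaken s d · ⊢ᴴ-weaken s e

⇒-refl : ⊢MK (A ⇒' A)
⇒-refl {A} = mp (mp axS axK) (axK {A} {A})

⊢ᴴ-deduction : A ∷ Γ ⊢ᴴ B → Γ ⊢ᴴ A ⇒' B
⊢ᴴ-deduction (hyp (here refl)) = thm ⇒-refl
⊢ᴴ-deduction (hyp (there p))   = thm axK · hyp p
⊢ᴴ-deduction (thm d)           = thm axK · thm d
⊢ᴴ-deduction (d · e)           = thm axS · ⊢ᴴ-deduction d · ⊢ᴴ-deduction e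

⊢ᴴ-closed : [] ⊢ᴴ A → ⊢MK A
⊢ᴴ-closed (hyp ())
⊢ᴴ-closed (thm d) = d
⊢ᴴ-closed (d · e) = mp (⊢ᴴ-closed d) (⊢ᴴ-closed e)

⊢ᴴ-nec : ∀ Σ → Σ ⊢ᴴ A → □* Σ ⊢ᴴ □ A
⊢ᴴ-nec []      d = thm (nec (⊢ᴴ-closed d))
⊢ᴴ-nec (B ∷ Σ) d = thm axK□ · ⊢ᴴ-weaken there (⊢ᴴ-nec Σ (⊢ᴴ-deduction d)) · hyp (here refl)

⊢ᴴ-replace-head : B ∷ Γ ⊢ᴴ A → A ∷ Γ ⊢ᴴ C → B ∷ Γ ⊢ᴴ C
⊢ᴴ-replace-head d e = ⊢ᴴ-deduction (⊢ᴴ-weaken (∷⁺ʳ _ (xs⊆x∷xs _ _)) e) · d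

⊢G1MK⇒⊢ᴴ : ⊢G1MK (Γ ⇒ C) → Γ ⊢ᴴ C
⊢G1MK⇒⊢ᴴ init       = hyp (here refl)
⊢G1MK⇒⊢ᴴ (perm π d) = ⊢ᴴ-weaken (⊆-reflexive-↭ π) (⊢G1MK⇒⊢ᴴ d)
⊢G1MK⇒⊢ᴴ (L∧₁ d)    = ⊢ᴴ-replace-head (thm ax∧₁ · hyp (here refl)) (⊢G1MK⇒⊢ᴴ d)
⊢G1MK⇒⊢ᴴ (L∧₂ d)    = ⊢ᴴ-replace-head (thm ax∧₂ · hyp (here refl)) (⊢G1MK⇒⊢ᴴ d)
⊢G1MK⇒⊢ᴴ (R∧ d e)   = thm ax∧I · thm ⇒-refl · (thm axK · ⊢G1MK⇒⊢ᴴ e) · ⊢G1MK⇒⊢ᴴ d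
⊢G1MK⇒⊢ᴴ (L∨ d e)   =
  thm ax∨E · ⊢ᴴ-weaken there (⊢ᴴ-deduction (⊢G1MK⇒⊢ᴴ d))
           · ⊢ᴴ-weaken there (⊢ᴴ-deduction (⊢G1MK⇒⊢ᴴ e)) · hyp (here refl)
⊢G1MK⇒⊢ᴴ (R∨₁ d)    = thm ax∨₁ · ⊢G1MK⇒⊢ᴴ d
⊢G1MK⇒⊢ᴴ (R∨₂ d)    = thm ax∨₂ · ⊢G1MK⇒⊢ᴴ d
⊢G1MK⇒⊢ᴴ (R→ d)     = ⊢ᴴ-deduction (⊢G1MK⇒⊢ᴴ d)
⊢G1MK⇒⊢ᴴ (L→ d e)   = ⊢ᴴ-replace-head (hyp (here refl) · ⊢ᴴ-weaken there (⊢G1MK⇒⊢ᴴ d)) (⊢G1MK⇒⊢ᴴ e)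
⊢G1MK⇒⊢ᴴ (LW d)     = ⊢ᴴ-weaken there (⊢G1MK⇒⊢ᴴ d)
⊢G1MK⇒⊢ᴴ (LC d)     = ⊢ᴴ-weaken (∈-∷⁺ʳ (here refl) ⊆-refl) (⊢G1MK⇒⊢ᴴ d)
⊢G1MK⇒⊢ᴴ (K□ d)     = ⊢ᴴ-nec _ (⊢G1MK⇒⊢ᴴ d)
⊢G1MK⇒⊢ᴴ (K◇ d)     =
  thm axK◇ · ⊢ᴴ-weaken there (⊢ᴴ-nec _ (⊢ᴴ-deduction (⊢G1MK⇒⊢ᴴ d))) · hyp (here refl)

unbox : Fm → List Fm
unbox (□ A) = [ A ]
unbox _     = []

unboxes : List Fm → List Fm
unboxes = concatMap unbox

unboxes-mono : Γ ⊆ Δ → unboxes Γ ⊆ unboxes Δ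
unboxes-mono = concatMap⁺ unbox

infix 3 _⊢_ _⊢ʳ_

data _⊢_  (Γ : List Fm) : Fm → Set
data _⊢ʳ_ (Γ : List Fm) : Fm → Set

data _⊢_ Γ where
  ax    : A ∈ Γ → Γ ⊢ A
  l∧    : A ∧' B ∈ Γ → A ∷ B ∷ Γ ⊢ C → Γ ⊢ C
  l∨    : A ∨' B ∈ Γ → A ∷ Γ ⊢ C → B ∷ Γ ⊢ C → Γ ⊢ C
  l→    : (A ⇒' B) ∈ Γ → Γ ⊢ A → B ∷ Γ ⊢ C → Γ ⊢ C
  right : Γ ⊢ʳ C → Γ ⊢ C

data _⊢ʳ_ Γ where
  r∧  : Γ ⊢ A → Γ ⊢ B → Γ ⊢ʳ A ∧' B
  r∨₁ : Γ ⊢ A → Γ ⊢ʳ A ∨' B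
  r∨₂ : Γ ⊢ B → Γ ⊢ʳ A ∨' B
  r→  : A ∷ Γ ⊢ B → Γ ⊢ʳ A ⇒' B
  k□  : unboxes Γ ⊢ A → Γ ⊢ʳ □ A
  k◇  : ◇ A ∈ Γ → A ∷ unboxes Γ ⊢ B → Γ ⊢ʳ ◇ B

⊢-weaken  : Γ ⊆ Δ → Γ ⊢ C → Δ ⊢ C
⊢ʳ-weaken : Γ ⊆ Δ → Γ ⊢ʳ C → Δ ⊢ʳ C

⊢-weaken s (ax p)      = ax (s p)
⊢-weaken s (l∧ p d)    = l∧ (s p) (⊢-weaken (∷⁺ʳ _ (∷⁺ʳ _ s)) d)
⊢-weaken s (l∨ p d e)  = l∨ (s p) (⊢-weaken (∷⁺ʳ _ s) d) (⊢-weaken (∷⁺ʳ _ s) e)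
⊢-weaken s (l→ p d e)  = l→ (s p) (⊢-weaken s d) (⊢-weaken (∷⁺ʳ _ s) e)
⊢-weaken s (right r)   = right (⊢ʳ-weaken s r)

⊢ʳ-weaken s (r∧ d e)   = r∧ (⊢-weaken s d) (⊢-weaken s e)
⊢ʳ-weaken s (r∨₁ d)    = r∨₁ (⊢-weaken s d)
⊢ʳ-weaken s (r∨₂ d)    = r∨₂ (⊢-weaken s d)
⊢ʳ-weaken s (r→ d)     = r→ (⊢-weaken (∷⁺ʳ _ s) d)
⊢ʳ-weaken s (k□ d)     = k□ (⊢-weaken (unboxes-mono s) d)
⊢ʳ-weaken s (k◇ p d)   = k◇ (s p) (⊢-weaken (∷⁺ʳ _ (unboxes-mono s)) d)

⊆-under : Δ ⊆ A ∷ Γ → X ∷ Δ ⊆ A ∷ X ∷ Γ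
⊆-under s = ⊆-trans (∷⁺ʳ _ s) (⊆-reflexive-↭ (swap _ _ refl))

⊆-under-prefix : ∀ Ξ → Δ ⊆ Ξ ++ Γ → X ∷ Δ ⊆ Ξ ++ X ∷ Γ
⊆-under-prefix Ξ s = ∈-∷⁺ʳ (xs⊆ys++xs _ Ξ (here refl)) (⊆-trans s (++⁺ʳ Ξ (xs⊆x∷xs _ _)))

-- The cut formula is removed from the right premise up to an inclusion s, so that
-- recursion on that premise stays structural (a weakened premise would not be).
cut       : ∀ A → Γ ⊢ A → Δ ⊢ C → Δ ⊆ A ∷ Γ → Γ ⊢ C
cut-right : ∀ A → Γ ⊢ʳ A → Δ ⊢ C → Δ ⊆ A ∷ Γ → Γ ⊢ C

-- In the premise of a modal rule the cut formula A survives only as unbox A.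
cut-unbox : ∀ A → Γ ⊢ʳ A → unbox A ++ Θ ⊢ C → unboxes Γ ⊆ Θ → Θ ⊢ C

cut A (ax p)       e s = ⊢-weaken (⊆-trans s (∈-∷⁺ʳ p ⊆-refl)) e
cut A (l∧ p d)     e s = l∧ p (cut A d e (⊆-trans s (∷⁺ʳ A (λ q → there (there q)))))
cut A (l∨ p d d′)  e s = l∨ p (cut A d e (⊆-trans s (∷⁺ʳ A there)))
                              (cut A d′ e (⊆-trans s (∷⁺ʳ A there)))
cut A (l→ p d d′)  e s = l→ p d (cut A d′ e (⊆-trans s (∷⁺ʳ A there)))
cut A (right r)    e s = cut-right A r e s

cut-right A r (ax q) s with s q
... | here refl = right r
... | there q′  = ax q′
cut-right A r (l∧ q e) s with s q
cut-right (X ∧' Y) (r∧ d d′) (l∧ q e) s | here refl =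
  cut X d (cut Y (⊢-weaken there d′)
                 (cut-right (X ∧' Y) (⊢ʳ-weaken (λ p → there (there p)) (r∧ d d′)) e
                            (⊆-under (⊆-under s)))
                 (⊆-reflexive-↭ (swap _ _ refl)))
          ⊆-refl
... | there q′ = l∧ q′ (cut-right A (⊢ʳ-weaken (λ p → there (there p)) r) e (⊆-under (⊆-under s)))
cut-right A r (l∨ q e e′) s with s q
cut-right (X ∨' Y) (r∨₁ d) (l∨ q e e′) s | here refl =
  cut X d (cut-right (X ∨' Y) (⊢ʳ-weaken there (r∨₁ d)) e (⊆-under s)) ⊆-refl
cut-right (X ∨' Y) (r∨₂ d) (l∨ q e e′) s | here refl =
  cut Y d (cut-right (X ∨' Y) (⊢ʳ-weaken there (r∨₂ d)) e′ (⊆-under s)) ⊆-refl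
... | there q′ = l∨ q′ (cut-right A (⊢ʳ-weaken there r) e (⊆-under s))
                       (cut-right A (⊢ʳ-weaken there r) e′ (⊆-under s))
cut-right A r (l→ q e e′) s with s q
cut-right (X ⇒' Y) (r→ d) (l→ q e e′) s | here refl =
  cut Y (cut X (cut-right (X ⇒' Y) (r→ d) e s) d ⊆-refl)
        (cut-right (X ⇒' Y) (⊢ʳ-weaken there (r→ d)) e′ (⊆-under s))
        ⊆-refl
... | there q′ = l→ q′ (cut-right A r e s) (cut-right A (⊢ʳ-weaken there r) e′ (⊆-under s))
cut-right A r (right (r∧ e e′)) s = right (r∧ (cut-right A r e s) (cut-right A r e′ s))
cut-right A r (right (r∨₁ e))   s = right (r∨₁ (cut-right A r e s))
cut-right A r (right (r∨₂ e))   s = right (r∨₂ (cut-right A r e s))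
cut-right A r (right (r→ e))    s = right (r→ (cut-right A (⊢ʳ-weaken there r) e (⊆-under s)))
cut-right A r (right (k□ e))    s =
  right (k□ (cut-unbox A r (⊢-weaken (unboxes-mono s) e) ⊆-refl))
cut-right A r (right (k◇ p e))  s with s p
cut-right (◇ X) (k◇ p′ d) (right (k◇ p e)) s | here refl =
  right (k◇ p′ (cut X d e (∷⁺ʳ X (⊆-trans (unboxes-mono s) (xs⊆x∷xs _ _)))))
... | there p′ =
  right (k◇ p′ (cut-unbox A r (⊢-weaken (⊆-under-prefix (unbox A) (unboxes-mono s)) e) (xs⊆x∷xs _ _)))

cut-unbox (□ A)    (k□ d) e t = cut A (⊢-weaken t d) e ⊆-refl
cut-unbox (var _)  ()
cut-unbox ⊥'       ()
cut-unbox (A ∧' B) r e t = e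
cut-unbox (A ∨' B) r e t = e
cut-unbox (A ⇒' B) r e t = e
cut-unbox (◇ A)    r e t = e

⊢MK⇒⊢ : ⊢MK A → Γ ⊢ A
⊢MK⇒⊢ ax∧₁ = right (r→ (l∧ (here refl) (ax (here refl))))
⊢MK⇒⊢ ax∧₂ = right (r→ (l∧ (here refl) (ax (there (here refl)))))
⊢MK⇒⊢ ax∨₁ = right (r→ (right (r∨₁ (ax (here refl)))))
⊢MK⇒⊢ ax∨₂ = right (r→ (right (r∨₂ (ax (here refl)))))
⊢MK⇒⊢ ax∧I = right (r→ (right (r→ (right (r→ (right (r∧
  (l→ (there (there (here refl))) (ax (here refl)) (ax (here refl)))
  (l→ (there (here refl)) (ax (here refl)) (ax (here refl))))))))))
⊢MK⇒⊢ ax∨E = right (r→ (right (r→ (right (r→ (l∨ (here refl)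
  (l→ (there (there (there (here refl)))) (ax (here refl)) (ax (here refl)))
  (l→ (there (there (here refl))) (ax (here refl)) (ax (here refl)))))))))
⊢MK⇒⊢ axS = right (r→ (right (r→ (right (r→
  (l→ (there (here refl)) (ax (here refl))
    (l→ (there (there (there (here refl)))) (ax (there (here refl)))
      (l→ (here refl) (ax (there (here refl))) (ax (here refl))))))))))
⊢MK⇒⊢ axK  = right (r→ (right (r→ (ax (there (here refl))))))
⊢MK⇒⊢ axK□ = right (r→ (right (r→ (right (k□
  (l→ (there (here refl)) (ax (here refl)) (ax (here refl))))))))
⊢MK⇒⊢ axK◇ = right (r→ (right (r→ (right (k◇ (here refl)
  (l→ (there (here refl)) (ax (here refl)) (ax (here refl))))))))
⊢MK⇒⊢ (mp d e) = cut _ (⊢MK⇒⊢ d) (l→ (here refl) (⊢MK⇒⊢ e) (ax (here refl))) ⊆-refl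
⊢MK⇒⊢ (nec d)  = right (k□ (⊢MK⇒⊢ d))

LW* : ∀ Δ → ⊢G1MK (Γ ⇒ C) → ⊢G1MK (Δ ++ Γ ⇒ C)
LW* []      d = d
LW* (A ∷ Δ) d = LW (LW* Δ d)

LC-∈ : A ∈ Γ → ⊢G1MK (A ∷ Γ ⇒ C) → ⊢G1MK (Γ ⇒ C)
LC-∈ p d with Γ₁ , Γ₂ , refl ← ∈-∃++ p =
  perm (↭-sym (shift _ Γ₁ Γ₂)) (LC (perm (prep _ (shift _ Γ₁ Γ₂)) d))

LC* : ∀ Γ → Γ ⊆ Δ → ⊢G1MK (Γ ++ Δ ⇒ C) → ⊢G1MK (Δ ⇒ C)
LC* []      s d = d
LC* (A ∷ Γ) s d = LC* Γ (λ p → s (there p)) (LC-∈ (xs⊆ys++xs _ Γ (s (here refl))) d)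

LW⊆ : Γ ⊆ Δ → ⊢G1MK (Γ ⇒ C) → ⊢G1MK (Δ ⇒ C)
LW⊆ {Γ} {Δ} s d = LC* Γ s (perm (++-comm Δ Γ) (LW* Δ d))

exchange : ⊢G1MK (A ∷ B ∷ Γ ⇒ C) → ⊢G1MK (B ∷ A ∷ Γ ⇒ C)
exchange = perm (swap _ _ refl)

unbox-∈ : ∀ {Z} → X ∈ unbox Z → □ X ≡ Z
unbox-∈ {Z = □ _} (here refl) = refl

□*-unboxes-⊆ : □* (unboxes Γ) ⊆ Γ
□*-unboxes-⊆ q with _ , p , refl ← ∈-map⁻ □_ q = Any.map unbox-∈ (∈-concatMap⁻ unbox p)

⊢⇒⊢G1MK  : Γ ⊢ C → ⊢G1MK (Γ ⇒ C)
⊢ʳ⇒⊢G1MK : Γ ⊢ʳ C → ⊢G1MK (Γ ⇒ C)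

⊢⇒⊢G1MK (ax p)     = LW⊆ (∈-∷⁺ʳ p (λ ())) init
⊢⇒⊢G1MK (l∧ p d)   = LC-∈ p (LC (L∧₁ (exchange (L∧₂ (exchange (⊢⇒⊢G1MK d))))))
⊢⇒⊢G1MK (l∨ p d e) = LC-∈ p (L∨ (⊢⇒⊢G1MK d) (⊢⇒⊢G1MK e))
⊢⇒⊢G1MK (l→ p d e) = LC-∈ p (L→ (⊢⇒⊢G1MK d) (⊢⇒⊢G1MK e))
⊢⇒⊢G1MK (right r)  = ⊢ʳ⇒⊢G1MK r

⊢ʳ⇒⊢G1MK (r∧ d e)  = R∧ (⊢⇒⊢G1MK d) (⊢⇒⊢G1MK e)
⊢ʳ⇒⊢G1MK (r∨₁ d)   = R∨₁ (⊢⇒⊢G1MK d)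
⊢ʳ⇒⊢G1MK (r∨₂ d)   = R∨₂ (⊢⇒⊢G1MK d)
⊢ʳ⇒⊢G1MK (r→ d)    = R→ (⊢⇒⊢G1MK d)
⊢ʳ⇒⊢G1MK (k□ d)    = LW⊆ □*-unboxes-⊆ (K□ (⊢⇒⊢G1MK d))
⊢ʳ⇒⊢G1MK (k◇ p d)  = LC-∈ p (LW⊆ (∷⁺ʳ _ □*-unboxes-⊆) (K◇ (⊢⇒⊢G1MK d)))

mainTheorem8 : (A : Fm) → (⊢G1MK ([] ⇒ A) → ⊢MK A) × (⊢MK A → ⊢G1MK ([] ⇒ A))
mainTheorem8 A = (λ d → ⊢ᴴ-closed (⊢G1MK⇒⊢ᴴ d)) , (λ d → ⊢⇒⊢G1MK (⊢MK⇒⊢ d))
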